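{- Let $k \geq 1$. Then every $n$-vertex graph $G$ with $\alpha(G) < n/(k+1)$ has an induced subgraph that is $k$-expanding on independent sets and a 2-connected subgraph that is weakly $k$-expanding on independent sets.
   Context: All graphs are finite and simple; $\alpha(G)$ is the independence number. For $X \subseteq V(G)$, $\partial_G X$ is the set of vertices of $V(G)\setminus X$ adjacent to at least one vertex of $X$. A graph $G$ is $k$-expanding on independent sets if every nonempty independent set $I$ of $G$ satisfies $|\partial_G I| > k|I|$. A graph $G$ is weakly $k$-expanding on independent sets if there is a vertex $v \in V(G)$ such that every nonempty independent set $I \subseteq V(G)\setminus\{v\}$ satisfies $|\partial_G I| > k|I|$. -}

module Defs where

open import Data.Nat using (ℕ; zero; suc; _+_; _*_; _≤_; _<_)
open import Data.Bool using (Bool; true; false; not; _∧_; _∨_; T)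
open import Data.Fin using (Fin; zero; suc; _≟_)
open import Data.Fin.Subset using (Subset; _∈_; _∉_; ∣_∣; Nonempty)
open import Data.Vec using (tabulate; lookup)
open import Data.Product using (Σ; _×_; _,_)
open import Relation.Binary.PropositionalEquality using (_≡_)
open import Relation.Nullary.Decidable using (⌊_⌋)
open import Function.Definitions using (Injective)

record Graph (n : ℕ) : Set where
  field
    adj   : Fin n → Fin n → Bool
    sym   : ∀ u v → adj u v ≡ adj v u
    irref : ∀ v → adj v v ≡ false
open Graph public

anyFin : ∀ {n} → (Fin n → Bool) → Bool
anyFin {zero}  f = false
anyFin {suc n} f = f zero ∨ anyFin (λ i → f (suc i))

Independent : ∀ {n} → Graph n → Subset n → Set
Independent G I = ∀ u v → u ∈ I → v ∈ I → adj G u v ≡ false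

IsIndependenceNumber : ∀ {n} → Graph n → ℕ → Set
IsIndependenceNumber G a =
  Σ (Subset _) (λ I → Independent G I × ∣ I ∣ ≡ a)
  × (∀ I → Independent G I → ∣ I ∣ ≤ a)

boundary : ∀ {n} → Graph n → Subset n → Subset n
boundary G X = tabulate λ v →
  not (lookup X v) ∧ anyFin (λ u → lookup X u ∧ adj G u v)

KExpanding : ∀ {n} → ℕ → Graph n → Set
KExpanding k G = ∀ I → Nonempty I → Independent G I → k * ∣ I ∣ < ∣ boundary G I ∣

WeaklyKExpanding : ∀ {n} → ℕ → Graph n → Set
WeaklyKExpanding {n} k G = Σ (Fin n) λ v →
  ∀ I → Nonempty I → v ∉ I → Independent G I → k * ∣ I ∣ < ∣ boundary G I ∣

data Reach {n} (G : Graph n) (allowed : Fin n → Bool) : Fin n → Fin n → Set where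
  here : ∀ {u} → T (allowed u) → Reach G allowed u u
  step : ∀ {u w v} → T (allowed u) → T (adj G u w) → Reach G allowed w v → Reach G allowed u v

-- The subgraph induced on {w | allowed w} is connected (nonemptiness handled separately).
ConnectedOn : ∀ {n} → Graph n → (Fin n → Bool) → Set
ConnectedOn G allowed = ∀ u v → T (allowed u) → T (allowed v) → Reach G allowed u v

-- 2-connected (Diestel): more than 2 vertices, and G − X connected for every |X| < 2.
TwoConnected : ∀ {n} → Graph n → Set
TwoConnected {n} G =
  3 ≤ n × ConnectedOn G (λ _ → true) × (∀ x → ConnectedOn G (λ v → not ⌊ v ≟ x ⌋))

IsSubgraphVia : ∀ {m n} → Graph m → Graph n → (Fin m → Fin n) → Set
IsSubgraphVia H G f = Injective _≡_ _≡_ f × (∀ u v → T (adj H u v) → T (adj G (f u) (f v)))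

IsInducedSubgraphVia : ∀ {m n} → Graph m → Graph n → (Fin m → Fin n) → Set
IsInducedSubgraphVia H G f = Injective _≡_ _≡_ f × (∀ u v → adj H u v ≡ adj G (f u) (f v))

module Submission where

-- Peel greedily: while some nonempty independent set I of the current vertex set A has at most
-- k|I| neighbours in A, delete I together with those neighbours.  The deleted independent sets
-- are pairwise anticomplete, so they form one independent set J, and at most (k+1)|J| ≤ (k+1)α(G) < n
-- vertices are deleted; the nonempty remainder A induces a k-expanding graph.
-- In G[A] every vertex has at least k+1 ≥ 2 neighbours.  Start from a connected piece C of G[A]
-- attached to the rest only through one vertex v.  If C ∪ {v} has a cut vertex x ∈ C, the component
-- of (C ∪ {v}) − x avoiding v is a smaller such piece, attached through x; otherwise C ∪ {v} is
-- 2-connected, and since an independent set inside C has all its neighbours in A within C ∪ {v},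
-- G[C ∪ {v}] is weakly k-expanding at v.

open import Defs hiding (sym)
open import Data.Nat using (ℕ; zero; suc; _+_; _*_; _≤_; _<_; z≤n; s≤s; _≤?_)
open import Data.Nat.Properties
  using (≤-trans; ≤-reflexive; <-≤-trans; +-mono-≤; +-monoˡ-≤; +-monoʳ-≤; +-suc; +-comm; +-assoc;
         *-monoʳ-≤; *-distribˡ-+; *-identityʳ; ≰⇒>; m≤m+n; +-cancelˡ-≤; +-cancelʳ-<; module ≤-Reasoning)
open import Data.Bool using (Bool; true; false; not; _∧_; T)
open import Data.Bool.Properties using (T-≡; T-∧; T-∨) renaming (_≟_ to _≟ᵇ_)
open import Data.Fin using (Fin; zero; suc; _≟_)
open import Data.Fin.Properties using (any?; all?; suc-injective)
open import Data.Fin.Subset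
open import Data.Fin.Subset.Properties
open import Data.Vec using ([]; _∷_; here; there; lookup)
open import Data.Vec.Properties using (lookup∘tabulate; []=⇒lookup; lookup⇒[]=)
open import Data.Product using (Σ; ∃; ∃₂; _×_; _,_; proj₁; proj₂)
open import Data.Sum using (_⊎_; inj₁; inj₂)
open import Data.Empty using (⊥-elim)
open import Function using (_∘_; id; Equivalence)
open import Function.Definitions using (Injective)
open import Data.Nat.Induction using (<-wellFounded)
open import Induction.WellFounded using (WellFounded; Acc; acc; module Subrelation)
import Relation.Binary.Construct.On as On
open import Relation.Binary.PropositionalEquality
  using (_≡_; _≢_; refl; sym; trans; cong; subst)
open import Relation.Nullary using (Dec; yes; no; contradiction)
open import Relation.Nullary.Decidable using (T?; ⌊_⌋; _×-dec_; _→-dec_; ¬?; decidable-stable)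

private
  variable
    n : ℕ
    p q : Subset n
    x y : Fin n

∈⇒T : x ∈ p → T (lookup p x)
∈⇒T x∈p = Equivalence.from T-≡ ([]=⇒lookup x∈p)

T⇒∈ : T (lookup p x) → x ∈ p
T⇒∈ {p = p} {x} t = lookup⇒[]= x p (Equivalence.to T-≡ t)

∉⇒T-not : x ∉ p → T (not (lookup p x))
∉⇒T-not {x = x} {p = p} x∉p with lookup p x in eq
... | true  = x∉p (lookup⇒[]= x p eq)
... | false = _

T-not⇒∉ : T (not (lookup p x)) → x ∉ p
T-not⇒∉ t x∈p = subst (T ∘ not) ([]=⇒lookup x∈p) t

x∈p─q⇒x∉q : x ∈ p ─ q → x ∉ q
x∈p─q⇒x∉q {p = _ ∷ _} {q = _ ∷ _} (there x∈p─q) (there x∈q) = x∈p─q⇒x∉q x∈p─q x∈q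

∣p∣≡∣p∩q∣+∣p─q∣ : ∀ (p q : Subset n) → ∣ p ∣ ≡ ∣ p ∩ q ∣ + ∣ p ─ q ∣
∣p∣≡∣p∩q∣+∣p─q∣ []            []            = refl
∣p∣≡∣p∩q∣+∣p─q∣ (true  ∷ p) (true  ∷ q) = cong suc (∣p∣≡∣p∩q∣+∣p─q∣ p q)
∣p∣≡∣p∩q∣+∣p─q∣ (true  ∷ p) (false ∷ q) =
  trans (cong suc (∣p∣≡∣p∩q∣+∣p─q∣ p q)) (sym (+-suc ∣ p ∩ q ∣ ∣ p ─ q ∣))
∣p∣≡∣p∩q∣+∣p─q∣ (false ∷ p) (true  ∷ q) = ∣p∣≡∣p∩q∣+∣p─q∣ p q
∣p∣≡∣p∩q∣+∣p─q∣ (false ∷ p) (false ∷ q) = ∣p∣≡∣p∩q∣+∣p─q∣ p q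

∣p∪q∣≤∣p∣+∣q∣ : ∀ (p q : Subset n) → ∣ p ∪ q ∣ ≤ ∣ p ∣ + ∣ q ∣
∣p∪q∣≤∣p∣+∣q∣ p q = begin
  ∣ p ∪ q ∣                         ≡⟨ ∣p∣≡∣p∩q∣+∣p─q∣ (p ∪ q) p ⟩
  ∣ (p ∪ q) ∩ p ∣ + ∣ (p ∪ q) ─ p ∣ ≤⟨ +-mono-≤ (∣p∩q∣≤∣q∣ (p ∪ q) p) (p⊆q⇒∣p∣≤∣q∣ ⊆q) ⟩
  ∣ p ∣ + ∣ q ∣                     ∎
  where
  open ≤-Reasoning
  ⊆q : (p ∪ q) ─ p ⊆ q
  ⊆q x∈ with x∈p∪q⁻ p q (p─q⊆p (p ∪ q) p x∈)
  ... | inj₁ x∈p = contradiction x∈p (x∈p─q⇒x∉q x∈)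
  ... | inj₂ x∈q = x∈q

∣p∣+∣q∣≤∣p∪q∣ : ∀ (p q : Subset n) → (∀ {x} → x ∈ p → x ∉ q) → ∣ p ∣ + ∣ q ∣ ≤ ∣ p ∪ q ∣
∣p∣+∣q∣≤∣p∪q∣ p q disjoint = begin
  ∣ p ∣ + ∣ q ∣                     ≤⟨ +-mono-≤ (p⊆q⇒∣p∣≤∣q∣ ⊆∩) (p⊆q⇒∣p∣≤∣q∣ ⊆─) ⟩
  ∣ (p ∪ q) ∩ p ∣ + ∣ (p ∪ q) ─ p ∣ ≡⟨ ∣p∣≡∣p∩q∣+∣p─q∣ (p ∪ q) p ⟨
  ∣ p ∪ q ∣                         ∎
  where
  open ≤-Reasoning
  ⊆∩ : p ⊆ (p ∪ q) ∩ p
  ⊆∩ x∈p = x∈p∩q⁺ (p⊆p∪q q x∈p , x∈p)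
  ⊆─ : q ⊆ (p ∪ q) ─ p
  ⊆─ x∈q = x∈p∧x∉q⇒x∈p─q (q⊆p∪q p q x∈q) (λ x∈p → disjoint x∈p x∈q)

0<∣p∣⇒Nonempty : ∀ {n} {p : Subset n} → 0 < ∣ p ∣ → Nonempty p
0<∣p∣⇒Nonempty {n = n} {p = p} 0<∣p∣ with nonempty? p
... | yes ne = ne
... | no ¬ne = contradiction (subst (0 <_) (trans (cong ∣_∣ (Empty-unique ¬ne)) (∣⊥∣≡0 n)) 0<∣p∣) λ ()

2≤∣p∣⇒∃≢ : 2 ≤ ∣ p ∣ → ∀ y → ∃ λ x → x ∈ p × x ≢ y
2≤∣p∣⇒∃≢ {p = p} 2≤∣p∣ y =
  let x , x∈p-y = 0<∣p∣⇒Nonempty (+-cancelˡ-≤ 1 1 ∣ p - y ∣ 2≤1+∣p-y∣)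
  in x , p─q⊆p p ⁅ y ⁆ x∈p-y , x∉⁅y⁆⇒x≢y (x∈p─q⇒x∉q x∈p-y)
  where
  open ≤-Reasoning
  2≤1+∣p-y∣ : 2 ≤ 1 + ∣ p - y ∣
  2≤1+∣p-y∣ = begin
    2                               ≤⟨ 2≤∣p∣ ⟩
    ∣ p ∣                           ≡⟨ ∣p∣≡∣p∩q∣+∣p─q∣ p ⁅ y ⁆ ⟩
    ∣ p ∩ ⁅ y ⁆ ∣ + ∣ p - y ∣       ≤⟨ +-monoˡ-≤ ∣ p - y ∣ (∣p∩q∣≤∣q∣ p ⁅ y ⁆) ⟩
    ∣ ⁅ y ⁆ ∣ + ∣ p - y ∣           ≡⟨ cong (_+ ∣ p - y ∣) (∣⁅x⁆∣≡1 y) ⟩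
    1 + ∣ p - y ∣                   ∎

3≤∣p∣ : ∀ {x y z : Fin n} → x ∈ p → y ∈ p → z ∈ p → x ≢ y → x ≢ z → y ≢ z → 3 ≤ ∣ p ∣
3≤∣p∣ {p = p} {x} {y} {z} x∈p y∈p z∈p x≢y x≢z y≢z =
  ≤-trans (s≤s (≤-trans (s≤s (≤-trans (s≤s z≤n) (x∈p⇒∣p-x∣<∣p∣ z∈p-x-y)))
                        (x∈p⇒∣p-x∣<∣p∣ y∈p-x)))
          (x∈p⇒∣p-x∣<∣p∣ x∈p)
  where
  y∈p-x = x∈p∧x≢y⇒x∈p-y y∈p (x≢y ∘ sym)
  z∈p-x-y = x∈p∧x≢y⇒x∈p-y (x∈p∧x≢y⇒x∈p-y z∈p (x≢z ∘ sym)) (y≢z ∘ sym)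

x∈p⇒⁅x⁆⊆p : x ∈ p → ⁅ x ⁆ ⊆ p
x∈p⇒⁅x⁆⊆p {x = x} {p = p} x∈p y∈ = subst (_∈ p) (sym (x∈⁅y⁆⇒x≡y x y∈)) x∈p

∪-lub : ∀ {p q r : Subset n} → p ⊆ r → q ⊆ r → p ∪ q ⊆ r
∪-lub {p = p} {q} p⊆r q⊆r x∈ with x∈p∪q⁻ p q x∈
... | inj₁ x∈p = p⊆r x∈p
... | inj₂ x∈q = q⊆r x∈q

p∪⁅x⁆-x⊆p : (p ∪ ⁅ x ⁆) - x ⊆ p
p∪⁅x⁆-x⊆p {p = p} {x = x} y∈ with x∈p∪q⁻ p ⁅ x ⁆ (p─q⊆p _ ⁅ x ⁆ y∈)
... | inj₁ y∈p = y∈p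
... | inj₂ y∈x = contradiction y∈x (x∈p─q⇒x∉q y∈)

p⊆p∪⁅x⁆-x : x ∉ p → p ⊆ (p ∪ ⁅ x ⁆) - x
p⊆p∪⁅x⁆-x x∉p y∈p = x∈p∧x≢y⇒x∈p-y (p⊆p∪q _ y∈p) λ { refl → x∉p y∈p }

all⊎any : ∀ {n} {P Q : Fin n → Set} → (∀ x → P x ⊎ Q x) → (∀ x → P x) ⊎ ∃ Q
all⊎any {zero}  _ = inj₁ λ ()
all⊎any {suc n} P⊎Q with P⊎Q zero | all⊎any (P⊎Q ∘ suc)
... | inj₂ q₀ | _             = inj₂ (zero , q₀)
... | inj₁ _  | inj₂ (x , qₓ) = inj₂ (suc x , qₓ)
... | inj₁ p₀ | inj₁ ps       = inj₁ λ { zero → p₀ ; (suc x) → ps x }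

⊂-wellFounded : WellFounded (_⊂_ {n = n})
⊂-wellFounded = Subrelation.wellFounded p⊂q⇒∣p∣<∣q∣ (On.wellFounded ∣_∣ <-wellFounded)

⊃-wellFounded : WellFounded (_⊃_ {n = n})
⊃-wellFounded = Subrelation.wellFounded p⊂q⇒∁p⊃∁q (On.wellFounded ∁ ⊂-wellFounded)

anyFin⁺ : ∀ {n} (f : Fin n → Bool) i → T (f i) → T (anyFin f)
anyFin⁺ f zero    t = Equivalence.from T-∨ (inj₁ t)
anyFin⁺ f (suc i) t = Equivalence.from (T-∨ {f zero}) (inj₂ (anyFin⁺ (f ∘ suc) i t))

anyFin⁻ : ∀ {n} (f : Fin n → Bool) → T (anyFin f) → ∃ λ i → T (f i)
anyFin⁻ {suc n} f t with Equivalence.to (T-∨ {f zero}) t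
... | inj₁ t₀ = zero , t₀
... | inj₂ t₁ = let i , tᵢ = anyFin⁻ (f ∘ suc) t₁ in suc i , tᵢ

module _ {n} (G : Graph n) where

  private
    variable
      S R : Subset n
      a b c h u v w : Fin n
      P Q : Fin n → Bool

  adj-symᵀ : T (adj G u v) → T (adj G v u)
  adj-symᵀ {u} {v} = subst T (Graph.sym G u v)

  adj⇒≢ : T (adj G u v) → u ≢ v
  adj⇒≢ {u} uv refl = subst T (Graph.irref G u) uv

  independent? : ∀ I → Dec (Independent G I)
  independent? I = all? λ u → all? λ v → u ∈? I →-dec v ∈? I →-dec adj G u v ≟ᵇ false

  ⁅u⁆-independent : ∀ u → Independent G ⁅ u ⁆
  ⁅u⁆-independent u x y x∈ y∈ rewrite x∈⁅y⁆⇒x≡y u x∈ | x∈⁅y⁆⇒x≡y u y∈ = Graph.irref G u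

  ∪-independent : ∀ {I J} → Independent G I → Independent G J →
                  (∀ {u v} → u ∈ I → v ∈ J → adj G u v ≡ false) → Independent G (I ∪ J)
  ∪-independent {I} {J} I-independent J-independent anticomplete u v u∈ v∈
    with x∈p∪q⁻ I J u∈ | x∈p∪q⁻ I J v∈
  ... | inj₁ u∈I | inj₁ v∈I = I-independent u v u∈I v∈I
  ... | inj₁ u∈I | inj₂ v∈J = anticomplete u∈I v∈J
  ... | inj₂ u∈J | inj₁ v∈I = trans (Graph.sym G u v) (anticomplete v∈I u∈J)
  ... | inj₂ u∈J | inj₂ v∈J = J-independent u v u∈J v∈J

  lookup-boundary : ∀ I v → lookup (boundary G I) v ≡ not (lookup I v) ∧ anyFin (λ u → lookup I u ∧ adj G u v)
  lookup-boundary I v = lookup∘tabulate _ v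

  ∈-boundary⁺ : ∀ {I} → v ∉ I → u ∈ I → T (adj G u v) → v ∈ boundary G I
  ∈-boundary⁺ {v} {u} {I} v∉I u∈I uv = T⇒∈ (subst T (sym (lookup-boundary I v))
    (Equivalence.from T-∧ (∉⇒T-not v∉I , anyFin⁺ _ u (Equivalence.from T-∧ (∈⇒T u∈I , uv)))))

  ∈-boundary⁻ : ∀ {I} → v ∈ boundary G I → v ∉ I × ∃ λ u → u ∈ I × T (adj G u v)
  ∈-boundary⁻ {v} {I} v∈ =
    let t₁ , t₂ = Equivalence.to T-∧ (subst T (lookup-boundary I v) (∈⇒T v∈))
        u , t₃ = anyFin⁻ _ t₂
        u∈I , uv = Equivalence.to T-∧ t₃
    in T-not⇒∉ t₁ , u , T⇒∈ u∈I , uv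

  reach-source : Reach G P a b → T (P a)
  reach-source (here t)     = t
  reach-source (step t _ _) = t

  reach-mono : (∀ {x} → T (P x) → T (Q x)) → Reach G P a b → Reach G Q a b
  reach-mono P⇒Q (here t)      = here (P⇒Q t)
  reach-mono P⇒Q (step t ab r) = step (P⇒Q t) ab (reach-mono P⇒Q r)

  reach-⊆ : S ⊆ R → Reach G (lookup S) a b → Reach G (lookup R) a b
  reach-⊆ S⊆R = reach-mono (∈⇒T ∘ S⊆R ∘ T⇒∈)

  reach-snoc : Reach G P a b → T (adj G b c) → T (P c) → Reach G P a c
  reach-snoc (here t)      bc tc = step t bc (here tc)
  reach-snoc (step t ab r) bc tc = step t ab (reach-snoc r bc tc)

  reach-trans : Reach G P a b → Reach G P b c → Reach G P a c
  reach-trans (here _)      r′ = r′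
  reach-trans (step t ab r) r′ = step t ab (reach-trans r r′)

  reach-sym : Reach G P a b → Reach G P b a
  reach-sym (here t)      = here t
  reach-sym (step t ab r) = reach-snoc (reach-sym r) (adj-symᵀ ab) t

  hub⇒connected : (∀ {x} → T (P x) → Reach G P h x) → ConnectedOn G P
  hub⇒connected from-hub x y tx ty = reach-trans (reach-sym (from-hub tx)) (from-hub ty)

  reach-exit : ∀ {D} → Reach G (lookup S) a b → a ∈ D → b ∉ D →
               ∃₂ λ x y → x ∈ D × y ∈ S × y ∉ D × T (adj G x y)
  reach-exit (here _) a∈D a∉D = contradiction a∈D a∉D
  reach-exit {D = D} (step {w = y} _ ay r) a∈D b∉D with y ∈? D
  ... | yes y∈D = reach-exit r y∈D b∉D
  ... | no  y∉D = _ , y , a∈D , T⇒∈ (reach-source r) , y∉D , ay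

  TwoConnectedOn : Subset n → Set
  TwoConnectedOn B = 3 ≤ ∣ B ∣ × ConnectedOn G (lookup B) × (∀ {x} → x ∈ B → ConnectedOn G (lookup (B - x)))

  NeighbourClosed : Subset n → Subset n → Set
  NeighbourClosed S R = ∀ {x y} → x ∈ R → y ∈ S → T (adj G x y) → y ∈ R

  reach-closed : NeighbourClosed S R → Reach G (lookup S) a b → a ∈ R → b ∈ R
  reach-closed {R = R} {b = b} closed r a∈R = decidable-stable (b ∈? R) λ b∉R →
    let _ , _ , x∈R , y∈S , y∉R , xy = reach-exit r a∈R b∉R in y∉R (closed x∈R y∈S xy)

  record Component (S : Subset n) (h : Fin n) : Set where
    field
      members    : Subset n
      members⊆S  : members ⊆ S
      h∈members  : h ∈ members
      closed     : NeighbourClosed S members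
      reachable  : ∀ {x} → x ∈ members → Reach G (lookup members) h x

    connected : ConnectedOn G (lookup members)
    connected = hub⇒connected (reachable ∘ T⇒∈)

  component : h ∈ S → Component S h
  component {h = h} {S = S} h∈S = grow ⁅ h ⁆ (⊃-wellFounded _) (x∈p⇒⁅x⁆⊆p h∈S) (x∈⁅x⁆ h) reach-⁅h⁆
    where
    reach-⁅h⁆ : ∀ {x} → x ∈ ⁅ h ⁆ → Reach G (lookup ⁅ h ⁆) h x
    reach-⁅h⁆ x∈ rewrite x∈⁅y⁆⇒x≡y h x∈ = here (∈⇒T (x∈⁅x⁆ h))
    grow : ∀ X → Acc _⊃_ X → X ⊆ S → h ∈ X → (∀ {x} → x ∈ X → Reach G (lookup X) h x) → Component S h
    grow X (acc smaller) X⊆S h∈X reach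
      with any? (λ x → any? λ y → x ∈? X ×-dec y ∈? S ×-dec ¬? (y ∈? X) ×-dec T? (adj G x y))
    ... | no no-exit = record
      { members = X ; members⊆S = X⊆S ; h∈members = h∈X ; reachable = reach
      ; closed = λ {_} {y} x∈X y∈S xy →
          decidable-stable (y ∈? X) λ y∉X → no-exit (_ , y , x∈X , y∈S , y∉X , xy) }
    ... | yes (x , y , x∈X , y∈S , y∉X , xy) =
      grow X′ (smaller X⊂X′) (∪-lub X⊆S (x∈p⇒⁅x⁆⊆p y∈S)) (X⊆X′ h∈X) reach′
      where
      X′ = X ∪ ⁅ y ⁆
      X⊆X′ : X ⊆ X′
      X⊆X′ = p⊆p∪q ⁅ y ⁆
      X⊂X′ : X ⊂ X′
      X⊂X′ = X⊆X′ , y , q⊆p∪q X ⁅ y ⁆ (x∈⁅x⁆ y) , y∉X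
      reach′ : ∀ {z} → z ∈ X′ → Reach G (lookup X′) h z
      reach′ z∈ with x∈p∪q⁻ X ⁅ y ⁆ z∈
      ... | inj₁ z∈X = reach-⊆ X⊆X′ (reach z∈X)
      ... | inj₂ z∈y rewrite x∈⁅y⁆⇒x≡y y z∈y =
        reach-snoc (reach-⊆ X⊆X′ (reach x∈X)) xy (∈⇒T (q⊆p∪q X ⁅ y ⁆ (x∈⁅x⁆ y)))

module _ {n} (G : Graph n) (k : ℕ) where

  private
    variable
      A D I : Subset n

  -- G[A] is k-expanding iff ExpandsWithin A A, and weakly k-expanding at v iff ExpandsWithin A (A - v).
  ExpandsWithin : Subset n → Subset n → Set
  ExpandsWithin A D = ∀ I → I ⊆ D → Nonempty I → Independent G I → k * ∣ I ∣ < ∣ boundary G I ∩ A ∣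

  Sparse : Subset n → Subset n → Set
  Sparse A I = I ⊆ A × Nonempty I × Independent G I × ∣ boundary G I ∩ A ∣ ≤ k * ∣ I ∣

  expands-or-sparse : ∀ A → ExpandsWithin A A ⊎ ∃ (Sparse A)
  expands-or-sparse A
    with anySubset? (λ I → I ⊆? A ×-dec nonempty? I ×-dec independent? G I ×-dec _ ≤? _)
  ... | yes sparse = inj₂ sparse
  ... | no ¬sparse = inj₁ λ I I⊆A ne ind → ≰⇒> λ few → ¬sparse (I , I⊆A , ne , ind , few)

  -- A is what survives after repeatedly deleting a sparse independent set together with its
  -- boundary; J collects the deleted independent sets.
  record Peeling (A : Subset n) : Set where
    field
      J              : Subset n
      J-independent  : Independent G J
      J-anticomplete : ∀ {u v} → u ∈ J → v ∈ A → adj G u v ≡ false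
      J-disjoint     : ∀ {u} → u ∈ J → u ∉ A
      size           : n ≤ ∣ A ∣ + suc k * ∣ J ∣

  peeling-⊤ : Peeling ⊤
  peeling-⊤ = record
    { J = ⊥ ; J-independent = λ _ _ u∈ _ → contradiction u∈ ∉⊥
    ; J-anticomplete = λ u∈ _ → contradiction u∈ ∉⊥ ; J-disjoint = λ u∈ _ → contradiction u∈ ∉⊥
    ; size = ≤-trans (≤-reflexive (sym (∣⊤∣≡n n))) (m≤m+n _ _) }

  sparse-deletion : ∀ A I → ∣ boundary G I ∩ A ∣ ≤ k * ∣ I ∣ →
                    ∣ A ∣ ≤ ∣ A ─ (I ∪ boundary G I) ∣ + suc k * ∣ I ∣
  sparse-deletion A I few = begin
    ∣ A ∣                                 ≡⟨ ∣p∣≡∣p∩q∣+∣p─q∣ A X ⟩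
    ∣ A ∩ X ∣ + ∣ A ─ X ∣                 ≤⟨ +-monoˡ-≤ ∣ A ─ X ∣ (p⊆q⇒∣p∣≤∣q∣ A∩X⊆I∪∂) ⟩
    ∣ I ∪ (boundary G I ∩ A) ∣ + ∣ A ─ X ∣  ≤⟨ +-monoˡ-≤ ∣ A ─ X ∣ (∣p∪q∣≤∣p∣+∣q∣ I _) ⟩
    ∣ I ∣ + ∣ boundary G I ∩ A ∣ + ∣ A ─ X ∣ ≤⟨ +-monoˡ-≤ ∣ A ─ X ∣ (+-monoʳ-≤ ∣ I ∣ few) ⟩
    suc k * ∣ I ∣ + ∣ A ─ X ∣             ≡⟨ +-comm (suc k * ∣ I ∣) ∣ A ─ X ∣ ⟩
    ∣ A ─ X ∣ + suc k * ∣ I ∣             ∎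
    where
    open ≤-Reasoning
    X = I ∪ boundary G I
    A∩X⊆I∪∂ : A ∩ X ⊆ I ∪ (boundary G I ∩ A)
    A∩X⊆I∪∂ x∈ with x∈p∩q⁻ A X x∈
    ... | x∈A , x∈X with x∈p∪q⁻ I (boundary G I) x∈X
    ...   | inj₁ x∈I = p⊆p∪q _ x∈I
    ...   | inj₂ x∈∂ = q⊆p∪q I _ (x∈p∩q⁺ (x∈∂ , x∈A))

  peel-sparse : Peeling A → Sparse A I → Peeling (A ─ (I ∪ boundary G I))
  peel-sparse {A} {I} peeling (I⊆A , _ , I-independent , few) = record
    { J = J ∪ I ; J-independent = ∪-independent G J-independent I-independent (λ u∈J v∈I → J-anticomplete u∈J (I⊆A v∈I)) ; J-anticomplete = J∪I-anticomplete
    ; J-disjoint = J∪I-disjoint ; size = size′ }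
    where
    open Peeling peeling
    X  = I ∪ boundary G I
    A′ = A ─ X
    J∪I-anticomplete : ∀ {u v} → u ∈ J ∪ I → v ∈ A′ → adj G u v ≡ false
    J∪I-anticomplete {u} {v} u∈ v∈A′ with x∈p∪q⁻ J I u∈
    ... | inj₁ u∈J = J-anticomplete u∈J (p─q⊆p A X v∈A′)
    ... | inj₂ u∈I with adj G u v in uv
    ...   | false = refl
    ...   | true  = ⊥-elim (x∈p─q⇒x∉q v∈A′ (q⊆p∪q I _ (∈-boundary⁺ G v∉I u∈I (Equivalence.from T-≡ uv))))
      where
      v∉I : v ∉ I
      v∉I v∈I = x∈p─q⇒x∉q v∈A′ (p⊆p∪q _ v∈I)
    J∪I-disjoint : ∀ {u} → u ∈ J ∪ I → u ∉ A′
    J∪I-disjoint u∈ u∈A′ with x∈p∪q⁻ J I u∈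
    ... | inj₁ u∈J = J-disjoint u∈J (p─q⊆p A X u∈A′)
    ... | inj₂ u∈I = x∈p─q⇒x∉q u∈A′ (p⊆p∪q (boundary G I) u∈I)
    open ≤-Reasoning
    size′ : n ≤ ∣ A′ ∣ + suc k * ∣ J ∪ I ∣
    size′ = begin
      n                                          ≤⟨ size ⟩
      ∣ A ∣ + suc k * ∣ J ∣                      ≤⟨ +-monoˡ-≤ _ (sparse-deletion A I few) ⟩
      ∣ A′ ∣ + suc k * ∣ I ∣ + suc k * ∣ J ∣     ≡⟨ +-assoc ∣ A′ ∣ _ _ ⟩
      ∣ A′ ∣ + (suc k * ∣ I ∣ + suc k * ∣ J ∣)   ≡⟨ cong (∣ A′ ∣ +_) (sym (*-distribˡ-+ (suc k) ∣ I ∣ ∣ J ∣)) ⟩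
      ∣ A′ ∣ + suc k * (∣ I ∣ + ∣ J ∣)           ≡⟨ cong (λ m → ∣ A′ ∣ + suc k * m) (+-comm ∣ I ∣ ∣ J ∣) ⟩
      ∣ A′ ∣ + suc k * (∣ J ∣ + ∣ I ∣)           ≤⟨ +-monoʳ-≤ ∣ A′ ∣ (*-monoʳ-≤ (suc k)
                                                      (∣p∣+∣q∣≤∣p∪q∣ J I λ u∈J u∈I → J-disjoint u∈J (I⊆A u∈I))) ⟩
      ∣ A′ ∣ + suc k * ∣ J ∪ I ∣                 ∎

  peel : Acc _⊂_ A → Peeling A → ∃ λ A′ → Peeling A′ × ExpandsWithin A′ A′
  peel {A} (acc smaller) peeling with expands-or-sparse A
  ... | inj₁ expands = A , peeling , expands
  ... | inj₂ (I , sparse@(I⊆A , (i , i∈I) , _)) =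
    peel (smaller (p∩q≢∅⇒p─q⊂p A (I ∪ boundary G I) (i , x∈p∩q⁺ (I⊆A i∈I , p⊆p∪q _ i∈I))))
         (peel-sparse peeling sparse)

  expanding-core : ∀ {a} → IsIndependenceNumber G a → suc k * a < n →
                   ∃ λ A → 0 < ∣ A ∣ × ExpandsWithin A A
  expanding-core {a} (_ , maximum) α-small with peel (⊂-wellFounded ⊤) peeling-⊤
  ... | A , peeling , expands = A , 0<∣A∣ , expands
    where
    open Peeling peeling
    open ≤-Reasoning
    0<∣A∣ : 0 < ∣ A ∣
    0<∣A∣ = +-cancelʳ-< (suc k * a) 0 ∣ A ∣ (begin-strict
      suc k * a             <⟨ α-small ⟩
      n                     ≤⟨ size ⟩
      ∣ A ∣ + suc k * ∣ J ∣ ≤⟨ +-monoʳ-≤ ∣ A ∣ (*-monoʳ-≤ (suc k) (maximum J J-independent)) ⟩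
      ∣ A ∣ + suc k * a     ∎)

module _ {n} {G : Graph n} {k : ℕ} (1≤k : 1 ≤ k) {A : Subset n} (A-expands : ExpandsWithin G k A A) where

  another-neighbour : ∀ {u} → u ∈ A → ∀ x → ∃ λ w → w ∈ A × w ≢ x × T (adj G u w)
  another-neighbour {u} u∈A x =
    let w , w∈∂∩A , w≢x = 2≤∣p∣⇒∃≢ 2≤∣∂∩A∣ x
        w∈∂ , w∈A = x∈p∩q⁻ _ _ w∈∂∩A
        _ , u′ , u′∈⁅u⁆ , u′w = ∈-boundary⁻ G w∈∂
    in w , w∈A , w≢x , subst (λ z → T (adj G z w)) (x∈⁅y⁆⇒x≡y u u′∈⁅u⁆) u′w
    where
    2≤∣∂∩A∣ : 2 ≤ ∣ boundary G ⁅ u ⁆ ∩ A ∣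
    2≤∣∂∩A∣ = ≤-trans (s≤s (≤-trans 1≤k (≤-reflexive (sym (trans (cong (k *_) (∣⁅x⁆∣≡1 u)) (*-identityʳ k))))))
                      (A-expands ⁅ u ⁆ (x∈p⇒⁅x⁆⊆p u∈A) (u , x∈⁅x⁆ u) (⁅u⁆-independent G u))

  record Pendant (v : Fin n) (C : Subset n) : Set where
    field
      v∈A         : v ∈ A
      C⊆A         : C ⊆ A
      v∉C         : v ∉ C
      attached    : ∃ λ c → c ∈ C × T (adj G v c)
      C-connected : ConnectedOn G (lookup C)
      C-closed    : ∀ {x y} → x ∈ C → y ∈ A → T (adj G x y) → y ∈ C ∪ ⁅ v ⁆

    block⊆A : C ∪ ⁅ v ⁆ ⊆ A
    block⊆A = ∪-lub C⊆A (x∈p⇒⁅x⁆⊆p v∈A)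

  component-pendant : ∀ {S x h} → x ∈ A → S ⊆ A → (D : Component G (S - x) h) →
                      (∀ {p y} → p ∈ Component.members D → y ∈ A → T (adj G p y) → y ∈ S) →
                      (∃ λ d → d ∈ Component.members D × T (adj G x d)) →
                      Pendant x (Component.members D)
  component-pendant {S} {x} x∈A S⊆A D leaves-into-S attached = record
    { v∈A = x∈A ; C⊆A = S⊆A ∘ p─q⊆p S ⁅ x ⁆ ∘ members⊆S ; v∉C = x∉D ; attached = attached
    ; C-connected = connected ; C-closed = closed′ }
    where
    open Component D
    x∉D : x ∉ members
    x∉D x∈D = x∈p─q⇒x∉q (members⊆S x∈D) (x∈⁅x⁆ x)
    closed′ : ∀ {p y} → p ∈ members → y ∈ A → T (adj G p y) → y ∈ members ∪ ⁅ x ⁆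
    closed′ {y = y} p∈D y∈A py with y ≟ x
    ... | yes refl = q⊆p∪q members ⁅ x ⁆ (x∈⁅x⁆ x)
    ... | no  y≢x  = p⊆p∪q ⁅ x ⁆ (closed p∈D (x∈p∧x≢y⇒x∈p-y (leaves-into-S p∈D y∈A py) y≢x) py)

  pendant-block : ∀ {v C} → Pendant v C → (∀ {x} → x ∈ C → ConnectedOn G (lookup ((C ∪ ⁅ v ⁆) - x))) →
                  TwoConnectedOn G (C ∪ ⁅ v ⁆) × ExpandsWithin G k (C ∪ ⁅ v ⁆) ((C ∪ ⁅ v ⁆) - v)
  pendant-block {v} {C} pendant cuts-connected = (3≤∣B∣ , B-connected , B-x-connected) , B-expands
    where
    open Pendant pendant
    B = C ∪ ⁅ v ⁆
    v∈B : v ∈ B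
    v∈B = q⊆p∪q C ⁅ v ⁆ (x∈⁅x⁆ v)
    C⊆B : C ⊆ B
    C⊆B = p⊆p∪q ⁅ v ⁆
    B-v⊆C : B - v ⊆ C
    B-v⊆C = p∪⁅x⁆-x⊆p
    c = proj₁ attached
    c∈C = proj₁ (proj₂ attached)
    vc = proj₂ (proj₂ attached)
    3≤∣B∣ : 3 ≤ ∣ B ∣
    3≤∣B∣ with another-neighbour (C⊆A c∈C) v
    ... | w , w∈A , w≢v , cw =
      3≤∣p∣ v∈B (C⊆B c∈C) (C-closed c∈C w∈A cw) (adj⇒≢ G vc) (w≢v ∘ sym) (adj⇒≢ G cw)
    from-v : ∀ {y} → T (lookup B y) → Reach G (lookup B) v y
    from-v {y} t with x∈p∪q⁻ C ⁅ v ⁆ (T⇒∈ t)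
    ... | inj₁ y∈C = step (∈⇒T v∈B) vc (reach-⊆ G C⊆B (C-connected c y (∈⇒T c∈C) (∈⇒T y∈C)))
    ... | inj₂ y∈v rewrite x∈⁅y⁆⇒x≡y v y∈v = here (∈⇒T v∈B)
    B-connected : ConnectedOn G (lookup B)
    B-connected = hub⇒connected G from-v
    B-x-connected : ∀ {x} → x ∈ B → ConnectedOn G (lookup (B - x))
    B-x-connected x∈B with x∈p∪q⁻ C ⁅ v ⁆ x∈B
    ... | inj₁ x∈C = cuts-connected x∈C
    ... | inj₂ x∈v rewrite x∈⁅y⁆⇒x≡y v x∈v = λ y z ty tz →
      reach-⊆ G (p⊆p∪⁅x⁆-x v∉C) (C-connected y z (∈⇒T (B-v⊆C (T⇒∈ ty))) (∈⇒T (B-v⊆C (T⇒∈ tz))))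
    ∂∩A⊆∂∩B : ∀ {I} → I ⊆ C → boundary G I ∩ A ⊆ boundary G I ∩ B
    ∂∩A⊆∂∩B I⊆C y∈ with x∈p∩q⁻ _ A y∈
    ... | y∈∂ , y∈A with ∈-boundary⁻ G y∈∂
    ...   | _ , u , u∈I , uy = x∈p∩q⁺ (y∈∂ , C-closed (I⊆C u∈I) y∈A uy)
    B-expands : ExpandsWithin G k B (B - v)
    B-expands I I⊆B-v ne independent = <-≤-trans
      (A-expands I (C⊆A ∘ I⊆C) ne independent) (p⊆q⇒∣p∣≤∣q∣ (∂∩A⊆∂∩B I⊆C))
      where
      I⊆C : I ⊆ C
      I⊆C = B-v⊆C ∘ I⊆B-v

  cut-or-connected : ∀ {v C} → Pendant v C → ∀ x →
                     (x ∈ C → ConnectedOn G (lookup ((C ∪ ⁅ v ⁆) - x))) ⊎ ∃ λ D → Pendant x D × D ⊂ C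
  cut-or-connected {v} {C} pendant x with x ∈? C
  ... | no x∉C = inj₁ λ x∈C → contradiction x∈C x∉C
  ... | yes x∈C = decide (any? λ u → u ∈? B - x ×-dec ¬? (u ∈? Component.members R))
    where
    open Pendant pendant
    B = C ∪ ⁅ v ⁆
    R = component G (x∈p∧x≢y⇒x∈p-y (q⊆p∪q C ⁅ v ⁆ (x∈⁅x⁆ v)) λ { refl → v∉C x∈C })
    decide : Dec (∃ λ u → u ∈ B - x × u ∉ Component.members R) →
             (x ∈ C → ConnectedOn G (lookup (B - x))) ⊎ ∃ λ D → Pendant x D × D ⊂ C
    decide (no none-separated) = inj₁ λ _ → hub⇒connected G λ {y} t →
      reach-⊆ G members⊆S (reachable (decidable-stable (y ∈? members) λ y∉R → none-separated (y , T⇒∈ t , y∉R)))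
      where open Component R
    decide (yes (u , u∈B-x , u∉R)) = inj₂ (members , pendant′ , D⊆C , x , x∈C , Pendant.v∉C pendant′)
      where
      D = component G u∈B-x
      open Component D
      v∉D : v ∉ members
      v∉D v∈D = u∉R (reach-closed G (Component.closed R)
        (reach-sym G (reach-⊆ G members⊆S (reachable v∈D))) (Component.h∈members R))
      D⊆C : members ⊆ C
      D⊆C {y} y∈D with x∈p∪q⁻ C ⁅ v ⁆ (p─q⊆p B ⁅ x ⁆ (members⊆S y∈D))
      ... | inj₁ y∈C = y∈C
      ... | inj₂ y∈v rewrite x∈⁅y⁆⇒x≡y v y∈v = contradiction y∈D v∉D
      x∉D : x ∉ members
      x∉D x∈D = x∈p─q⇒x∉q (members⊆S x∈D) (x∈⁅x⁆ x)
      attached′ : ∃ λ d → d ∈ members × T (adj G x d)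
      attached′ with reach-exit G (C-connected u x (∈⇒T (D⊆C h∈members)) (∈⇒T x∈C)) h∈members x∉D
      ... | d , y , d∈D , y∈C , y∉D , dy with y ≟ x
      ...   | yes refl = d , d∈D , adj-symᵀ G dy
      ...   | no  y≢x  = contradiction (closed d∈D (x∈p∧x≢y⇒x∈p-y (p⊆p∪q ⁅ v ⁆ y∈C) y≢x) dy) y∉D
      pendant′ : Pendant x members
      pendant′ = component-pendant (C⊆A x∈C) block⊆A D (λ p∈D y∈A py → C-closed (D⊆C p∈D) y∈A py) attached′

  ExpandingBlock : Set
  ExpandingBlock = ∃₂ λ B v → v ∈ B × TwoConnectedOn G B × ExpandsWithin G k B (B - v)

  pendant⇒block : ∀ {v C} → Acc _⊂_ C → Pendant v C → ExpandingBlock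
  pendant⇒block {v} {C} (acc smaller) pendant with all⊎any (cut-or-connected pendant)
  ... | inj₁ cuts-connected = C ∪ ⁅ v ⁆ , v , q⊆p∪q C ⁅ v ⁆ (x∈⁅x⁆ v) ,
                              pendant-block pendant (cuts-connected _)
  ... | inj₂ (_ , D , pendant′ , D⊂C) = pendant⇒block (smaller D⊂C) pendant′

  initial-pendant : Nonempty A → ∃₂ Pendant
  initial-pendant (u , u∈A) with another-neighbour u∈A u
  ... | w , w∈A , w≢u , uw =
    u , members , component-pendant u∈A id D (λ _ y∈A _ → y∈A) (w , h∈members , uw)
    where
    D = component G (x∈p∧x≢y⇒x∈p-y w∈A w≢u)
    open Component D

  expanding⇒block : Nonempty A → ExpandingBlock
  expanding⇒block ne with initial-pendant ne
  ... | _ , C , pendant = pendant⇒block (⊂-wellFounded C) pendant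

enum : ∀ {n} (B : Subset n) → Fin ∣ B ∣ → Fin n
enum (true  ∷ B) zero    = zero
enum (true  ∷ B) (suc i) = suc (enum B i)
enum (false ∷ B) i       = suc (enum B i)

enum-∈ : ∀ {n} (B : Subset n) i → enum B i ∈ B
enum-∈ (true  ∷ B) zero    = here
enum-∈ (true  ∷ B) (suc i) = there (enum-∈ B i)
enum-∈ (false ∷ B) i       = there (enum-∈ B i)

enum-injective : ∀ {n} (B : Subset n) → Injective _≡_ _≡_ (enum B)
enum-injective (true  ∷ B) {zero}  {zero}  _  = refl
enum-injective (true  ∷ B) {suc i} {suc j} eq = cong suc (enum-injective B (suc-injective eq))
enum-injective (false ∷ B)                 eq = enum-injective B (suc-injective eq)

enum-surjective : ∀ {n} (B : Subset n) {x} → x ∈ B → ∃ λ i → enum B i ≡ x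
enum-surjective (true  ∷ B) here       = zero , refl
enum-surjective (true  ∷ B) (there x∈) = let i , eq = enum-surjective B x∈ in suc i , cong suc eq
enum-surjective (false ∷ B) (there x∈) = let i , eq = enum-surjective B x∈ in i , cong suc eq

image : ∀ {n} (B : Subset n) → Subset ∣ B ∣ → Subset n
image []          []      = []
image (true  ∷ B) (b ∷ I) = b ∷ image B I
image (false ∷ B) I       = false ∷ image B I

∣image∣ : ∀ {n} (B : Subset n) I → ∣ image B I ∣ ≡ ∣ I ∣
∣image∣ []          []          = refl
∣image∣ (true  ∷ B) (true  ∷ I) = cong suc (∣image∣ B I)
∣image∣ (true  ∷ B) (false ∷ I) = ∣image∣ B I
∣image∣ (false ∷ B) I           = ∣image∣ B I

∈-image⁺ : ∀ {n} (B : Subset n) {I i} → i ∈ I → enum B i ∈ image B I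
∈-image⁺ (true  ∷ B) {_ ∷ I} here       = here
∈-image⁺ (true  ∷ B) {_ ∷ I} (there i∈) = there (∈-image⁺ B i∈)
∈-image⁺ (false ∷ B)         i∈         = there (∈-image⁺ B i∈)

∈-image⁻ : ∀ {n} (B : Subset n) {I x} → x ∈ image B I → ∃ λ i → i ∈ I × enum B i ≡ x
∈-image⁻ (true  ∷ B) {_ ∷ I} here       = zero , here , refl
∈-image⁻ (true  ∷ B) {_ ∷ I} (there x∈) = let i , i∈ , eq = ∈-image⁻ B x∈ in suc i , there i∈ , cong suc eq
∈-image⁻ (false ∷ B)         (there x∈) = let i , i∈ , eq = ∈-image⁻ B x∈ in i , i∈ , cong suc eq

preimage : ∀ {n} (B : Subset n) → Subset n → Subset ∣ B ∣
preimage []          []      = []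
preimage (true  ∷ B) (b ∷ Q) = b ∷ preimage B Q
preimage (false ∷ B) (_ ∷ Q) = preimage B Q

∣preimage∣ : ∀ {n} (B : Subset n) Q → ∣ preimage B Q ∣ ≡ ∣ Q ∩ B ∣
∣preimage∣ []          []          = refl
∣preimage∣ (true  ∷ B) (true  ∷ Q) = cong suc (∣preimage∣ B Q)
∣preimage∣ (true  ∷ B) (false ∷ Q) = ∣preimage∣ B Q
∣preimage∣ (false ∷ B) (true  ∷ Q) = ∣preimage∣ B Q
∣preimage∣ (false ∷ B) (false ∷ Q) = ∣preimage∣ B Q

∈-preimage⁺ : ∀ {n} (B : Subset n) {Q i} → enum B i ∈ Q → i ∈ preimage B Q
∈-preimage⁺ (true  ∷ B) {_ ∷ Q} {zero}  here       = here
∈-preimage⁺ (true  ∷ B) {_ ∷ Q} {suc i} (there i∈) = there (∈-preimage⁺ B i∈)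
∈-preimage⁺ (false ∷ B) {_ ∷ Q}         (there i∈) = ∈-preimage⁺ B i∈

∈-preimage⁻ : ∀ {n} (B : Subset n) {Q i} → i ∈ preimage B Q → enum B i ∈ Q
∈-preimage⁻ (true  ∷ B) {_ ∷ Q} {zero}  here       = here
∈-preimage⁻ (true  ∷ B) {_ ∷ Q} {suc i} (there i∈) = there (∈-preimage⁻ B i∈)
∈-preimage⁻ (false ∷ B) {_ ∷ Q}         i∈         = there (∈-preimage⁻ B i∈)

induced : ∀ {n} → Graph n → (B : Subset n) → Graph ∣ B ∣
induced G B = record
  { adj   = λ i j → adj G (enum B i) (enum B j)
  ; sym   = λ i j → Graph.sym G (enum B i) (enum B j)
  ; irref = λ i → Graph.irref G (enum B i) }

module _ {n} (G : Graph n) (B : Subset n) where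

  private
    H = induced G B
    variable
      I : Subset ∣ B ∣
      S : Subset n
      P : Fin ∣ B ∣ → Bool

  induced-independent : Independent H I → Independent G (image B I)
  induced-independent {I} independent u v u∈ v∈
    with ∈-image⁻ B u∈ | ∈-image⁻ B v∈
  ... | i , i∈I , refl | j , j∈I , refl = independent i j i∈I j∈I

  boundary-induced : boundary H I ≡ preimage B (boundary G (image B I))
  boundary-induced {I} = ⊆-antisym ⊆preimage preimage⊆
    where
    enum-∉-image : ∀ {i} → i ∉ I → enum B i ∉ image B I
    enum-∉-image i∉I x∈ with ∈-image⁻ B x∈
    ... | _ , j∈I , eq rewrite enum-injective B eq = i∉I j∈I
    ⊆preimage : boundary H I ⊆ preimage B (boundary G (image B I))
    ⊆preimage i∈ with ∈-boundary⁻ H i∈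
    ... | i∉I , j , j∈I , ji = ∈-preimage⁺ B (∈-boundary⁺ G (enum-∉-image i∉I) (∈-image⁺ B j∈I) ji)
    preimage⊆ : preimage B (boundary G (image B I)) ⊆ boundary H I
    preimage⊆ i∈ with ∈-boundary⁻ G (∈-preimage⁻ B i∈)
    ... | x∉image , u , u∈image , ux with ∈-image⁻ B u∈image
    ...   | j , j∈I , refl = ∈-boundary⁺ H (x∉image ∘ ∈-image⁺ B) j∈I ux

  induced-expands : ∀ {k D} → ExpandsWithin G k B D → ∀ I → image B I ⊆ D →
                    Nonempty I → Independent H I → k * ∣ I ∣ < ∣ boundary H I ∣
  induced-expands {k} expands I image⊆D (i , i∈I) independent = begin-strict
    k * ∣ I ∣                          ≡⟨ cong (k *_) (∣image∣ B I) ⟨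
    k * ∣ image B I ∣                  <⟨ expands (image B I) image⊆D (enum B i , ∈-image⁺ B i∈I)
                                                  (induced-independent independent) ⟩
    ∣ boundary G (image B I) ∩ B ∣     ≡⟨ ∣preimage∣ B _ ⟨
    ∣ preimage B (boundary G (image B I)) ∣ ≡⟨ cong ∣_∣ boundary-induced ⟨
    ∣ boundary H I ∣                   ∎
    where open ≤-Reasoning

  reach-induced : S ⊆ B → (∀ {i} → enum B i ∈ S → T (P i)) →
                  ∀ {a b} → Reach G (lookup S) a b → ∀ {i j} → enum B i ≡ a → enum B j ≡ b → Reach H P i j
  reach-induced S⊆B S⇒P (here a∈S) {i} {j} refl eq =
    subst (Reach H _ i) (enum-injective B (sym eq)) (here (S⇒P (T⇒∈ a∈S)))
  reach-induced S⊆B S⇒P (step a∈S ac r) refl eq with enum-surjective B (S⊆B (T⇒∈ (reach-source G r)))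
  ... | l , refl = step (S⇒P (T⇒∈ a∈S)) ac (reach-induced S⊆B S⇒P r refl eq)

  connected-induced : S ⊆ B → (∀ {i} → enum B i ∈ S → T (P i)) → (∀ {i} → T (P i) → enum B i ∈ S) →
                      ConnectedOn G (lookup S) → ConnectedOn H P
  connected-induced S⊆B S⇒P P⇒S connected i j ti tj =
    reach-induced S⊆B S⇒P (connected (enum B i) (enum B j) (∈⇒T (P⇒S ti)) (∈⇒T (P⇒S tj))) refl refl

  induced-two-connected : TwoConnectedOn G B → TwoConnected H
  induced-two-connected (3≤∣B∣ , B-connected , B-x-connected) =
    3≤∣B∣ ,
    connected-induced id _ (λ {i} _ → enum-∈ B i) B-connected ,
    λ x → connected-induced (p─q⊆p B _) (minus⇒≢ x) (≢⇒minus x) (B-x-connected (enum-∈ B x))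
    where
    minus⇒≢ : ∀ x {i} → enum B i ∈ B - enum B x → T (not ⌊ i ≟ x ⌋)
    minus⇒≢ x {i} i∈ with i ≟ x
    ... | yes refl = x∈p─q⇒x∉q i∈ (x∈⁅x⁆ (enum B i))
    ... | no  _    = _
    ≢⇒minus : ∀ x {i} → T (not ⌊ i ≟ x ⌋) → enum B i ∈ B - enum B x
    ≢⇒minus x {i} t with i ≟ x
    ... | no i≢x = x∈p∧x≢y⇒x∈p-y (enum-∈ B i) (i≢x ∘ enum-injective B)

  induced-weakly-expanding : ∀ {k v} → v ∈ B → ExpandsWithin G k B (B - v) → WeaklyKExpanding k H
  induced-weakly-expanding {k} {v} v∈B expands with enum-surjective B v∈B
  ... | i₀ , refl = i₀ , λ I ne i₀∉I → induced-expands {k} expands I (image⊆B-v i₀∉I) ne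
    where
    image⊆B-v : ∀ {I} → i₀ ∉ I → image B I ⊆ B - enum B i₀
    image⊆B-v i₀∉I x∈ with ∈-image⁻ B x∈
    ... | i , i∈I , refl = x∈p∧x≢y⇒x∈p-y (enum-∈ B i) λ eq → i₀∉I (subst (_∈ _) (enum-injective B eq) i∈I)

  induced-expanding : ∀ {k} → ExpandsWithin G k B B → KExpanding k H
  induced-expanding {k} expands I = induced-expands {k} expands I image⊆B
    where
    image⊆B : image B I ⊆ B
    image⊆B x∈ with ∈-image⁻ B x∈
    ... | i , _ , refl = enum-∈ B i

lemma1 : (k : ℕ) → 1 ≤ k → (n : ℕ) → (G : Graph n) → (a : ℕ) →
    IsIndependenceNumber G a → suc k * a < n →
    (Σ ℕ λ m → Σ (Graph m) λ H → Σ (Fin m → Fin n) λ f →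
        1 ≤ m × IsInducedSubgraphVia H G f × KExpanding k H)
    × (Σ ℕ λ m → Σ (Graph m) λ H → Σ (Fin m → Fin n) λ f →
        IsSubgraphVia H G f × TwoConnected H × WeaklyKExpanding k H)
lemma1 k 1≤k n G a α α-small with expanding-core G k α α-small
... | A , 0<∣A∣ , A-expands with expanding⇒block 1≤k A-expands (0<∣p∣⇒Nonempty 0<∣A∣)
...   | B , v , v∈B , B-two-connected , B-expands =
  ( ∣ A ∣ , induced G A , enum A , 0<∣A∣
  , (enum-injective A , λ _ _ → refl) , induced-expanding G A {k} A-expands ) ,
  ( ∣ B ∣ , induced G B , enum B
  , (enum-injective B , λ _ _ → id) , induced-two-connected G B B-two-connected
  , induced-weakly-expanding G B {k} v∈B B-expands )
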